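{- For every graph $G$ with $\omega(G)\ge 2$, $\pi^\circ(G)>\log_2\log_3(\omega(G)-1)$ (where the right side is $-\infty$ when $\omega(G)=2$). In particular $\pi^\circ(K_n)>\log_2\log_3(n-1)$ for $n\ge 2$.
   Context: $\omega(G)$ is the largest $t$ such that $K_t\subseteq G$. Two edges are nonincident if they share no endpoint. A circular ordering of $V(G)$ separates a pair $\{xy,zw\}$ of nonincident edges if the endpoints of the two edges do not alternate around the cycle. The circular separation dimension $\pi^\circ(G)$ is the minimum number of circular orderings of $V(G)$ such that every pair of nonincident edges is separated by at least one of them ($0$ if there are no such pairs). -}

module Defs where

open import Data.Nat using (ℕ; _<_; _≤_)
open import Data.Nat.Base using (_⊓_; _⊔_)
open import Data.Fin using (Fin; toℕ)
open import Data.Fin.Properties using (_≟_)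
open import Data.Fin.Permutation using (Permutation′; _⟨$⟩ʳ_)
open import Data.Bool using (Bool; true; false; not)
open import Data.Product using (Σ; ∃; _×_)
open import Relation.Nullary using (¬_)
open import Relation.Nullary.Decidable using (⌊_⌋)
open import Relation.Binary.PropositionalEquality using (_≡_; _≢_; refl)
open import Function.Bundles using (_⇔_)
open import Function.Definitions using (Injective)

record Graph (n : ℕ) : Set where
  field
    adj  : Fin n → Fin n → Bool
    sym  : ∀ x y → adj x y ≡ adj y x
    irr  : ∀ x → adj x x ≡ false
open Graph public

K : (n : ℕ) → Graph n
K n = record { adj = λ x y → not ⌊ x ≟ y ⌋ ; sym = symK ; irr = irrK }
  where
  symK : ∀ x y → not ⌊ x ≟ y ⌋ ≡ not ⌊ y ≟ x ⌋
  symK x y with x ≟ y | y ≟ x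
  ... | Relation.Nullary.yes _ | Relation.Nullary.yes _ = refl
  ... | Relation.Nullary.no _  | Relation.Nullary.no _  = refl
  ... | Relation.Nullary.yes refl | Relation.Nullary.no q = Data.Empty.⊥-elim (q refl)
    where import Data.Empty
  ... | Relation.Nullary.no q | Relation.Nullary.yes refl = Data.Empty.⊥-elim (q refl)
    where import Data.Empty
  irrK : ∀ x → not ⌊ x ≟ x ⌋ ≡ false
  irrK x with x ≟ x
  ... | Relation.Nullary.yes _ = refl
  ... | Relation.Nullary.no q = Data.Empty.⊥-elim (q refl)
    where import Data.Empty

HasClique : ∀ {n} → Graph n → ℕ → Set
HasClique {n} G t = Σ (Fin t → Fin n) λ f →
  Injective _≡_ _≡_ f × (∀ i j → i ≢ j → adj G (f i) (f j) ≡ true)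

IsCliqueNumber : ∀ {n} → Graph n → ℕ → Set
IsCliqueNumber G w = HasClique G w × (∀ t → HasClique G t → t ≤ w)

-- A circular ordering of V(G) = Fin n, given by a bijection
-- vertex ↦ position in {0,…,n-1} read cyclically.
CircOrd : ℕ → Set
CircOrd n = Permutation′ n

pos : ∀ {n} → CircOrd n → Fin n → ℕ
pos σ v = toℕ (σ ⟨$⟩ʳ v)

Between : ∀ {n} → CircOrd n → Fin n → Fin n → Fin n → Set
Between σ x y u = (pos σ x ⊓ pos σ y < pos σ u) × (pos σ u < pos σ x ⊔ pos σ y)

-- The endpoints of xy and zw do not alternate around the cycle:
-- z and w lie on the same side of the chord xy.
Separates : ∀ {n} → CircOrd n → Fin n → Fin n → Fin n → Fin n → Set
Separates σ x y z w = Between σ x y z ⇔ Between σ x y w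

NonincidentEdges : ∀ {n} → Graph n → Fin n → Fin n → Fin n → Fin n → Set
NonincidentEdges G x y z w =
  adj G x y ≡ true × adj G z w ≡ true ×
  x ≢ z × x ≢ w × y ≢ z × y ≢ w

SeparatingFamily : ∀ {n} → Graph n → (k : ℕ) → (Fin k → CircOrd n) → Set
SeparatingFamily G k σs = ∀ x y z w → NonincidentEdges G x y z w →
  ∃ λ i → Separates (σs i) x y z w

HasSepFamily : ∀ {n} → Graph n → ℕ → Set
HasSepFamily {n} G k = Σ (Fin k → CircOrd n) (SeparatingFamily G k)

-- π°(G) = p : the minimum number of circular orderings in a separating family
-- (0 when there are no nonincident edge pairs, since then the empty family works).
IsCircSepDim : ∀ {n} → Graph n → ℕ → Set
IsCircSepDim G p = HasSepFamily G p × (∀ k → k < p → ¬ HasSepFamily G k)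

module Submission where

-- Erdős–Szekeres: a sequence longer than a² has a monotone subsequence of length a + 1.
-- Applying it once per ordering, a clique with more than 3^(2^p) vertices, listed in any
-- fixed order, has four vertices v₀ v₁ v₂ v₃ whose positions are monotone in each of the
-- p circular orderings.  In every such ordering v₁ lies on the arc between v₀ and v₂
-- while v₃ does not, so the nonincident edges v₀v₂ and v₁v₃ are separated by none of them.

open import Defs
open import Data.Nat using (ℕ; _<_; _≤_; _∸_; _^_)
open import Data.Product using (_×_)

open import Data.Nat using (zero; suc; _+_; _*_; z≤n; s≤s; _≤?_)
open import Data.Nat.Properties hiding (_≟_)
open import Data.Fin using (Fin) renaming (zero to fzero; suc to fsuc)
open import Data.Fin.Properties using (toℕ-injective; _≟_)
open import Data.List using (List; []; _∷_; length; tabulate)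
open import Data.List.Properties using (length-tabulate)
open import Data.List.Relation.Unary.All as All using ([]; _∷_)
open import Data.List.Relation.Unary.AllPairs using (AllPairs; []; _∷_)
open import Data.List.Relation.Unary.AllPairs.Properties using (tabulate⁺)
open import Data.List.Relation.Binary.Sublist.Propositional
  using (_⊆_; []; _∷_; _∷ʳ_; ⊆-refl; ⊆-trans; minimum)
open import Data.List.Relation.Binary.Sublist.Propositional.Properties using (All-resp-⊆)
open import Data.Product using (∃-syntax; _,_; proj₁; proj₂)
open import Data.Bool using (true)
open import Data.Sum using (_⊎_; inj₁; inj₂)
open import Function using (id; _∘_)
open import Function.Bundles using (Equivalence; Injection)
open import Function.Properties.Inverse using (↔⇒↣)
open import Relation.Nullary using (¬_; yes; no; contradiction)
open import Relation.Binary.PropositionalEquality using (_≡_; _≢_; refl; cong; subst; module ≡-Reasoning)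
  renaming (sym to ≡-sym)

AllPairs-resp-⊆ : ∀ {A : Set} {R : A → A → Set} {xs ys} → xs ⊆ ys → AllPairs R ys → AllPairs R xs
AllPairs-resp-⊆ []           []         = []
AllPairs-resp-⊆ (_ ∷ʳ xs⊆)   (_ ∷ Rys)  = AllPairs-resp-⊆ xs⊆ Rys
AllPairs-resp-⊆ (refl ∷ xs⊆) (Ry ∷ Rys) = All-resp-⊆ xs⊆ Ry ∷ AllPairs-resp-⊆ xs⊆ Rys

n*[1+o]<1+m+p⇒n*o<p : ∀ {m n} o p → m < n → n * suc o < suc (m + p) → n * o < p
n*[1+o]<1+m+p⇒n*o<p {m} {n} o p m<n bound = +-cancelˡ-≤ m _ _ (begin
  m + suc (n * o) ≡⟨ +-suc m (n * o) ⟩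
  suc m + n * o   ≤⟨ +-monoˡ-≤ (n * o) m<n ⟩
  n + n * o       ≡⟨ ≡-sym (*-suc n o) ⟩
  n * suc o       ≤⟨ ≤-pred bound ⟩
  m + p           ∎)
  where open ≤-Reasoning

module ErdősSzekeres {A : Set} (g : A → ℕ) where

  Ascending Descending Monotone : List A → Set
  Ascending  = AllPairs (λ x y → g x < g y)
  Descending = AllPairs (λ x y → g y ≤ g x)
  Monotone xs = Ascending xs ⊎ Descending xs

  LongSublist : (List A → Set) → ℕ → List A → Set
  LongSublist P k xs = ∃[ ys ] ys ⊆ xs × P ys × k ≤ length ys

  Monotone-resp-⊆ : ∀ {xs ys} → xs ⊆ ys → Monotone ys → Monotone xs
  Monotone-resp-⊆ xs⊆ys (inj₁ asc)  = inj₁ (AllPairs-resp-⊆ xs⊆ys asc)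
  Monotone-resp-⊆ xs⊆ys (inj₂ desc) = inj₂ (AllPairs-resp-⊆ xs⊆ys desc)

  greedyAscent leftover : A → List A → List A
  greedyAscent m [] = []
  greedyAscent m (z ∷ zs) with suc (g m) ≤? g z
  ... | yes _ = z ∷ greedyAscent z zs
  ... | no _  = greedyAscent m zs

  leftover m [] = []
  leftover m (z ∷ zs) with suc (g m) ≤? g z
  ... | yes _ = leftover z zs
  ... | no _  = z ∷ leftover m zs

  greedyAscent-ascending : ∀ m zs → Ascending (m ∷ greedyAscent m zs)
  greedyAscent-ascending m [] = [] ∷ []
  greedyAscent-ascending m (z ∷ zs) with suc (g m) ≤? g z
  ... | no _ = greedyAscent-ascending m zs
  ... | yes m<z with greedyAscent-ascending z zs
  ...   | z<rest ∷ asc = (m<z ∷ All.map (<-trans m<z) z<rest) ∷ z<rest ∷ asc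

  greedyAscent-⊆ : ∀ m zs → greedyAscent m zs ⊆ zs
  greedyAscent-⊆ m [] = []
  greedyAscent-⊆ m (z ∷ zs) with suc (g m) ≤? g z
  ... | yes _ = refl ∷ greedyAscent-⊆ z zs
  ... | no _  = z ∷ʳ greedyAscent-⊆ m zs

  leftover-⊆ : ∀ m zs → leftover m zs ⊆ zs
  leftover-⊆ m [] = []
  leftover-⊆ m (z ∷ zs) with suc (g m) ≤? g z
  ... | yes _ = z ∷ʳ leftover-⊆ z zs
  ... | no _  = refl ∷ leftover-⊆ m zs

  length-greedyAscent+leftover : ∀ m zs →
    length (greedyAscent m zs) + length (leftover m zs) ≡ length zs
  length-greedyAscent+leftover m [] = refl
  length-greedyAscent+leftover m (z ∷ zs) with suc (g m) ≤? g z
  ... | yes _ = cong suc (length-greedyAscent+leftover z zs)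
  ... | no _  = begin
    length (greedyAscent m zs) + suc (length (leftover m zs))
      ≡⟨ +-suc (length (greedyAscent m zs)) _ ⟩
    suc (length (greedyAscent m zs) + length (leftover m zs))
      ≡⟨ cong suc (length-greedyAscent+leftover m zs) ⟩
    suc (length zs) ∎
    where open ≡-Reasoning

  private
    skip-second : ∀ {xs : List A} {m z zs} → xs ⊆ (m ∷ zs) → xs ⊆ (m ∷ z ∷ zs)
    skip-second {z = z} (m ∷ʳ xs⊆) = m ∷ʳ z ∷ʳ xs⊆
    skip-second {z = z} (eq ∷ xs⊆) = eq ∷ z ∷ʳ xs⊆

  -- An element d was put into the leftover because it does not exceed the element kept
  -- last before it, so that element can be put in front of a descending run starting at d.
  leftover-descending-extends : ∀ m zs d ds → (d ∷ ds) ⊆ leftover m zs → Descending (d ∷ ds) →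
    LongSublist Descending (suc (suc (length ds))) (m ∷ zs)
  leftover-descending-extends m (z ∷ zs) d ds sub desc with suc (g m) ≤? g z
  ... | yes _ with leftover-descending-extends z zs d ds sub desc
  ...   | es , es⊆ , desc′ , long = es , m ∷ʳ es⊆ , desc′ , long
  leftover-descending-extends m (z ∷ zs) d ds (z ∷ʳ sub) desc | no _
    with leftover-descending-extends m zs d ds sub desc
  ... | es , es⊆ , desc′ , long = es , skip-second es⊆ , desc′ , long
  leftover-descending-extends m (z ∷ zs) z ds (refl ∷ sub) desc@(z≥ds ∷ _) | no m≮z =
    m ∷ z ∷ ds , refl ∷ refl ∷ ⊆-trans sub (leftover-⊆ m zs) ,
    (z≤m ∷ All.map (λ d≤z → ≤-trans d≤z z≤m) z≥ds) ∷ desc , ≤-refl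
    where
    z≤m : g z ≤ g m
    z≤m = ≮⇒≥ m≮z

  erdős–szekeres : ∀ a b xs → a * b < length xs →
    LongSublist Ascending (suc a) xs ⊎ LongSublist Descending (suc b) xs
  erdős–szekeres a zero (x ∷ xs) _ = inj₂ (x ∷ [] , refl ∷ minimum xs , [] ∷ [] , s≤s z≤n)
  erdős–szekeres a (suc b) (x ∷ xs) a*[1+b]<1+xs
    with suc a ≤? length (x ∷ greedyAscent x xs)
  ... | yes long = inj₁ (_ , refl ∷ greedyAscent-⊆ x xs , greedyAscent-ascending x xs , long)
  ... | no short with erdős–szekeres a b (leftover x xs) a*b<leftover
    where
    a*b<leftover : a * b < length (leftover x xs)
    a*b<leftover = n*[1+o]<1+m+p⇒n*o<p b _ (≤-pred (≰⇒> short))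
      (subst (λ l → a * suc b < suc l) (≡-sym (length-greedyAscent+leftover x xs)) a*[1+b]<1+xs)
  ...   | inj₁ (ys , ys⊆ , asc , long) = inj₁ (ys , ⊆-trans ys⊆ (x ∷ʳ leftover-⊆ x xs) , asc , long)
  ...   | inj₂ (d ∷ ds , ds⊆ , desc , long) with leftover-descending-extends x xs d ds ds⊆ desc
  ...     | es , es⊆ , desc′ , longer = inj₂ (es , es⊆ , desc′ , ≤-trans (s≤s long) longer)

  monotone-sublist : ∀ a xs → a * a < length xs → LongSublist Monotone (suc a) xs
  monotone-sublist a xs a*a<xs with erdős–szekeres a a xs a*a<xs
  ... | inj₁ (ys , ys⊆ , asc , long)  = ys , ys⊆ , inj₁ asc , long
  ... | inj₂ (ys , ys⊆ , desc , long) = ys , ys⊆ , inj₂ desc , long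

open ErdősSzekeres using (Monotone; Monotone-resp-⊆; monotone-sublist)

^-2^-suc : ∀ n k → n ^ (2 ^ suc k) ≡ n ^ (2 ^ k) * n ^ (2 ^ k)
^-2^-suc n k = begin
  n ^ (2 ^ k + (2 ^ k + 0))      ≡⟨ ^-distribˡ-+-* n (2 ^ k) (2 ^ k + 0) ⟩
  n ^ (2 ^ k) * n ^ (2 ^ k + 0)  ≡⟨ cong (λ e → n ^ (2 ^ k) * n ^ e) (+-identityʳ (2 ^ k)) ⟩
  n ^ (2 ^ k) * n ^ (2 ^ k)      ∎
  where open ≡-Reasoning

simultaneously-monotone-sublist : ∀ {A : Set} n k (gs : Fin k → A → ℕ) xs →
  n ^ (2 ^ k) < length xs →
  ∃[ ys ] ys ⊆ xs × n < length ys × (∀ i → Monotone (gs i) ys)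
simultaneously-monotone-sublist n zero gs xs long =
  xs , ⊆-refl , subst (_< length xs) (^-identityʳ n) long , λ ()
simultaneously-monotone-sublist n (suc k) gs xs long
  with monotone-sublist (gs fzero) (n ^ (2 ^ k)) xs (subst (_< length xs) (^-2^-suc n k) long)
... | ys , ys⊆xs , mono , ys-long
  with simultaneously-monotone-sublist n k (gs ∘ fsuc) ys ys-long
...   | zs , zs⊆ys , zs-long , monos =
  zs , ⊆-trans zs⊆ys ys⊆xs , zs-long ,
  λ { fzero → Monotone-resp-⊆ (gs fzero) zs⊆ys mono ; (fsuc i) → monos i }

pos-injective : ∀ {n} (σ : CircOrd n) {u v} → pos σ u ≡ pos σ v → u ≡ v
pos-injective σ = Injection.injective (↔⇒↣ σ) ∘ toℕ-injective

module _ {n} (σ : CircOrd n) where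

  between-ascending : ∀ {x y u} → pos σ x < pos σ u → pos σ u < pos σ y → Between σ x y u
  between-ascending x<u u<y = ≤-<-trans (m⊓n≤m _ _) x<u , <-≤-trans u<y (m≤n⊔m _ _)

  between-descending : ∀ {x y u} → pos σ y < pos σ u → pos σ u < pos σ x → Between σ x y u
  between-descending y<u u<x = ≤-<-trans (m⊓n≤n _ _) y<u , <-≤-trans u<x (m≤m⊔n _ _)

  monotone-chords-cross : ∀ {v₀ v₁ v₂ v₃ vs} → v₀ ≢ v₁ → v₁ ≢ v₂ →
    Monotone (pos σ) (v₀ ∷ v₁ ∷ v₂ ∷ v₃ ∷ vs) → ¬ Separates σ v₀ v₂ v₁ v₃
  monotone-chords-cross _ _ (inj₁ ((v₀<v₁ ∷ _ ∷ v₀<v₃ ∷ _) ∷ (v₁<v₂ ∷ _) ∷ (v₂<v₃ ∷ _) ∷ _)) sep =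
    <⇒≱ (proj₂ (Equivalence.to sep (between-ascending v₀<v₁ v₁<v₂)))
        (⊔-lub (<⇒≤ v₀<v₃) (<⇒≤ v₂<v₃))
  monotone-chords-cross v₀≢v₁ v₁≢v₂
    (inj₂ ((v₁≤v₀ ∷ _ ∷ v₃≤v₀ ∷ _) ∷ (v₂≤v₁ ∷ _) ∷ (v₃≤v₂ ∷ _) ∷ _)) sep =
    <⇒≱ (proj₁ (Equivalence.to sep (between-descending v₂<v₁ v₁<v₀)))
        (⊓-glb v₃≤v₀ v₃≤v₂)
    where
    v₁<v₀ = ≤∧≢⇒< v₁≤v₀ (v₀≢v₁ ∘ ≡-sym ∘ pos-injective σ)
    v₂<v₁ = ≤∧≢⇒< v₂≤v₁ (v₁≢v₂ ∘ ≡-sym ∘ pos-injective σ)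

clique-size-bound : ∀ {n} (G : Graph n) {w p} → HasClique G w → HasSepFamily G p →
  w ≤ 3 ^ (2 ^ p)
clique-size-bound {n} G {w} {p} (f , f-injective , f-adjacent) (σs , separating) =
  ≮⇒≥ λ long → no-monotone-quadruple
    (simultaneously-monotone-sublist 3 p (pos ∘ σs) clique
      (subst (3 ^ (2 ^ p) <_) (≡-sym (length-tabulate f)) long))
  where
  clique : List (Fin n)
  clique = tabulate f

  clique-edges : AllPairs (λ u v → u ≢ v × adj G u v ≡ true) clique
  clique-edges = tabulate⁺ λ {i} {j} i≢j → i≢j ∘ f-injective , f-adjacent i j i≢j

  no-monotone-quadruple :
    ¬ (∃[ vs ] vs ⊆ clique × 3 < length vs × (∀ i → Monotone (pos (σs i)) vs))
  no-monotone-quadruple (v₀ ∷ v₁ ∷ v₂ ∷ v₃ ∷ _ , vs⊆ , _ , monos)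
    with AllPairs-resp-⊆ vs⊆ clique-edges
  ... | ((v₀≢v₁ , _) ∷ (v₀≢v₂ , v₀v₂) ∷ (v₀≢v₃ , _) ∷ _) ∷ ((v₁≢v₂ , _) ∷ (_ , v₁v₃) ∷ _)
        ∷ ((v₂≢v₃ , _) ∷ _) ∷ _
    with separating v₀ v₂ v₁ v₃ (v₀v₂ , v₁v₃ , v₀≢v₁ , v₀≢v₃ , v₁≢v₂ ∘ ≡-sym , v₂≢v₃)
  ...   | i , sep = monotone-chords-cross (σs i) v₀≢v₁ v₁≢v₂ (monos i) sep
  no-monotone-quadruple ([] , _ , () , _)
  no-monotone-quadruple (_ ∷ [] , _ , s≤s () , _)
  no-monotone-quadruple (_ ∷ _ ∷ [] , _ , s≤s (s≤s ()) , _)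
  no-monotone-quadruple (_ ∷ _ ∷ _ ∷ [] , _ , s≤s (s≤s (s≤s ())) , _)

≤⇒∸1< : ∀ {m n} → 0 < n → m ≤ n → m ∸ 1 < n
≤⇒∸1< {zero}  0<n _   = 0<n
≤⇒∸1< {suc m} _   m<n = m<n

clique-bound : ∀ {n} (G : Graph n) {w p} → HasClique G w → HasSepFamily G p →
  w ∸ 1 < 3 ^ (2 ^ p)
clique-bound G {p = p} clique family =
  ≤⇒∸1< (m^n>0 3 (2 ^ p)) (clique-size-bound G clique family)

K-hasClique : ∀ n → HasClique (K n) n
K-hasClique n = id , id , distinct⇒adjacent
  where
  distinct⇒adjacent : ∀ i j → i ≢ j → adj (K n) i j ≡ true
  distinct⇒adjacent i j i≢j with i ≟ j
  ... | yes i≡j = contradiction i≡j i≢j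
  ... | no _    = refl

-- Only a clique of size ω(G) and a separating family of size π°(G) are needed;
-- the hypothesis ω(G) ≥ 2 is not.
mainTheorem16 : (∀ n (G : Graph n) (w p : ℕ) → IsCliqueNumber G w → IsCircSepDim G p →
    2 ≤ w → w ∸ 1 < 3 ^ (2 ^ p))
    ×
    (∀ n (p : ℕ) → 2 ≤ n → IsCircSepDim (K n) p → n ∸ 1 < 3 ^ (2 ^ p))
mainTheorem16 =
  (λ n G w p ω π° _ → clique-bound G (proj₁ ω) (proj₁ π°)) ,
  (λ n p _ π° → clique-bound (K n) (K-hasClique n) (proj₁ π°))
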